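{- Let $G$ be a finite simple undirected graph in which every vertex has degree at least $2$, and let $G'$ be the graph constructed from $G$ as described in the context. Let $M$ be a maximal (inclusion-wise) matching in $G'$. Then for each $v\in V(G)$ there exists a matching $N_v$ of $G'$ which differs from $M$ only on edges of $E(W_v)$, which satisfies either $N_v=M$ or $|N_v\cap E(W_v)|=|M\cap E(W_v)|+1$, and for which, with $k:=|M\cap F_v|$, \[ |N_v\cap (E(W_v)\cup F_v)| = \begin{cases} d(v)-1, & \text{if } 0\le k\le 1,\\ d(v), & \text{if } k\ge 2.\end{cases} \]
   Context: For a vertex $v$ of $G$, $\delta(v)$ is the set of edges of $G$ incident to $v$ and $d(v)=|\delta(v)|$. The graph $G'$ is built from $G$ as follows (the vertices of $G$ themselves do not appear in $G'$). For each edge $e=\{u,v\}\in E(G)$, $G'$ has three vertices $u'_e$, $x_e$, $v'_e$ and the two edges $\{u'_e,x_e\}$ and $\{x_e,v'_e\}$ (the "connecting edges"). For each vertex $v\in V(G)$, $G'$ additionally has $d(v)-2$ vertices $v''_1,\dots,v''_{d(v)-2}$, all edges $\{v''_i,v'_e\}$ for $1\le i\le d(v)-2$ and $e\in\delta(v)$, and one "special edge" $g_v=\{v'_e,v'_f\}$ for a fixed, arbitrarily chosen pair of distinct edges $e,f\in\delta(v)$. For $v\in V(G)$, $W_v$ denotes the subgraph of $G'$ induced by $\{v''_1,\dots,v''_{d(v)-2}\}\cup\{v'_e: e\in\delta(v)\}$ (its edges are the edges $\{v''_i,v'_e\}$ together with $g_v$), and $F_v:=\{\{v'_e,x_e\}: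 e\in\delta(v)\}$. -}

module Defs where

open import Data.Nat using (ℕ; zero; suc; _∸_; _<_; _≤ᵇ_)
open import Data.Fin using (Fin; toℕ)
open import Data.Bool using (Bool; true; false; if_then_else_)
open import Data.List using (List; []; _∷_; length; filterᵇ; allFin; map; concatMap; upTo)
open import Data.Product using (_×_; _,_; proj₁; proj₂; Σ)
open import Data.Sum using (_⊎_)
open import Data.Empty using (⊥)
open import Data.Unit using (⊤)
open import Relation.Nullary using (¬_)
open import Relation.Binary.PropositionalEquality using (_≡_; _≢_)

record SimpleGraph (n : ℕ) : Set where
  field
    adj    : Fin n → Fin n → Bool
    sym    : ∀ u v → adj u v ≡ adj v u
    irrefl : ∀ v → adj v v ≡ false
open SimpleGraph public

module _ {n : ℕ} (G : SimpleGraph n) where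

  -- neighbours of v; the edges of δ(v) are {v,u} for u a neighbour
  nbrs : Fin n → List (Fin n)
  nbrs v = filterᵇ (adj G v) (allFin n)

  deg : Fin n → ℕ
  deg v = length (nbrs v)

  -- The arbitrary choice of the special edge g_v: for every vertex v two
  -- distinct edges e = {v, fst v}, f = {v, snd v} of δ(v).
  record SpecialChoice : Set where
    field
      fst  : Fin n → Fin n
      snd  : Fin n → Fin n
      fstAdj : ∀ v → adj G v (fst v) ≡ true
      sndAdj : ∀ v → adj G v (snd v) ≡ true
      distinct : ∀ v → fst v ≢ snd v
  open SpecialChoice public

-- Vertices of G'.
--   port v u  = v'_e   for e = {v,u}
--   xv u v    = x_e    for e = {u,v}, stored with toℕ u ≤ toℕ v
--   inner v i = v''_(i+1)  (0-based index, 0 ≤ i < d(v)-2)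
data Vtx (n : ℕ) : Set where
  port  : Fin n → Fin n → Vtx n
  xv    : Fin n → Fin n → Vtx n
  inner : Fin n → ℕ → Vtx n

xOf : {n : ℕ} → Fin n → Fin n → Vtx n
xOf u v = if toℕ u ≤ᵇ toℕ v then xv u v else xv v u

-- Edge labels of G'.
--   conn v u      = {v'_e , x_e}        (e = {v,u}); these form F_v
--   wedge v i u   = {v''_(i+1) , v'_e}  (e = {v,u})
--   special v     = g_v
data Edg (n : ℕ) : Set where
  conn    : Fin n → Fin n → Edg n
  wedge   : Fin n → ℕ → Fin n → Edg n
  special : Fin n → Edg n

module _ {n : ℕ} (G : SimpleGraph n) (S : SpecialChoice G) where

  -- which labels really are edges of G'
  Valid : Edg n → Set
  Valid (conn v u)    = adj G v u ≡ true
  Valid (wedge v i u) = adj G v u ≡ true × i < deg G v ∸ 2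
  Valid (special v)   = ⊤

  ends : Edg n → Vtx n × Vtx n
  ends (conn v u)    = port v u , xOf v u
  ends (wedge v i u) = inner v i , port v u
  ends (special v)   = port v (fst S v) , port v (snd S v)

  IsEnd : Vtx n → Edg n → Set
  IsEnd x e = x ≡ proj₁ (ends e) ⊎ x ≡ proj₂ (ends e)

  EdgeSet : Set
  EdgeSet = Edg n → Bool

  IsMatching : EdgeSet → Set
  IsMatching M =
    (∀ e → M e ≡ true → Valid e) ×
    (∀ e f x → M e ≡ true → M f ≡ true → IsEnd x e → IsEnd x f → e ≡ f)

  _⊆_ : EdgeSet → EdgeSet → Set
  A ⊆ B = ∀ e → A e ≡ true → B e ≡ true

  IsMaximalMatching : EdgeSet → Set
  IsMaximalMatching M =
    IsMatching M × (∀ M' → IsMatching M' → M ⊆ M' → M' ⊆ M)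

  InW : Fin n → Edg n → Set
  InW v (conn _ _)    = ⊥
  InW v (wedge w i u) = w ≡ v × Valid (wedge w i u)
  InW v (special w)   = w ≡ v

  -- explicit (duplicate-free) lists of E(W_v) and F_v
  edgesW : Fin n → List (Edg n)
  edgesW v = special v ∷ concatMap (λ u → map (λ i → wedge v i u) (upTo (deg G v ∸ 2))) (nbrs G v)

  edgesF : Fin n → List (Edg n)
  edgesF v = map (conn v) (nbrs G v)

  -- |A ∩ L| for a duplicate-free list L of edges
  card∩ : EdgeSet → List (Edg n) → ℕ
  card∩ A L = length (filterᵇ A L)

module Submission where

-- Fix v, put d = d(v) and m = d − 2, and let k, w and s be the numbers of M-edges in F_v,
-- among the edges {v''_i, v'_e} of W_v, and on g_v. Each port v'_e lies on at most one M-edge,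
-- so k + w + 2s ≤ d, and each v''_i does too, so w ≤ m. If w < m, some v''_i is free, and
-- maximality then forces every port to be covered, so k + w + 2s = d.
-- Either |M ∩ (E(W_v) ∪ F_v)| = s + w + k already has the required value, and N_v = M; or
-- k = s = 0 and w = m, and N_v replaces M ∩ E(W_v) by g_v together with a matching of the
-- remaining d − 2 ports into the v''_i; or s = 1, k ≥ 2 and every port is covered, and N_v
-- replaces M ∩ E(W_v) by a matching of the d − k ports not covered by F_v into the v''_i.
-- Outside E(W_v) the only edges at the ports are those of F_v, and the new edges avoid the
-- ports covered by M ∩ F_v, so N_v is again a matching; it has one more edge in E(W_v).

open import Data.Nat renaming (_≟_ to _≟ⁿ_)
open import Data.Nat.Properties
open import Data.Bool using (Bool; true; false; _∧_; not; if_then_else_)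
open import Data.Bool.Properties using (∧-zeroʳ; T-≡)
open import Data.Fin using (Fin; toℕ) renaming (_≟_ to _≟ᶠ_)
open import Data.List using (List; []; _∷_; length; filterᵇ; map; concatMap; concat; _++_; upTo; allFin)
open import Data.List.Properties using (length-upTo)
open import Data.List.Membership.Propositional using (_∈_)
open import Data.List.Membership.Propositional.Properties
  using (∈-filter⁺; ∈-filter⁻; ∈-allFin; ∈-upTo⁺; ∈-upTo⁻)
open import Data.List.Relation.Unary.Any using (here; there)
open import Data.List.Relation.Unary.All as All using ()
open import Data.List.Relation.Unary.AllPairs using (_∷_)
open import Data.List.Relation.Unary.Unique.Propositional using (Unique)
open import Data.List.Relation.Unary.Unique.Propositional.Properties using (filter⁺; allFin⁺; upTo⁺)
open import Data.Product using (_×_; _,_; Σ; proj₁; proj₂)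
open import Data.Sum using (_⊎_; inj₁; inj₂)
open import Data.Empty using (⊥; ⊥-elim)
open import Function.Bundles using (Equivalence)
open import Relation.Nullary using (¬_; Dec; yes; no; does)
open import Relation.Nullary.Decidable using (T?; dec-true)
open import Relation.Binary.PropositionalEquality
open import Algebra.Properties.CommutativeSemigroup +-commutativeSemigroup using (interchange)
open import Defs hiding (sym)

-- Sums over lists

𝟙 : Bool → ℕ
𝟙 true  = 1
𝟙 false = 0

does⇒witness : {P : Set} (d : Dec P) → does d ≡ true → P
does⇒witness (yes p) _ = p

∑ : {A : Set} → List A → (A → ℕ) → ℕ
∑ []       f = 0
∑ (x ∷ xs) f = f x + ∑ xs f

syntax ∑ xs (λ x → e) = ∑[ x ∈ xs ] e

module _ {A : Set} where

  length-filterᵇ : ∀ (p : A → Bool) xs → length (filterᵇ p xs) ≡ ∑[ x ∈ xs ] 𝟙 (p x)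
  length-filterᵇ p [] = refl
  length-filterᵇ p (x ∷ xs) with p x
  ... | true  = cong suc (length-filterᵇ p xs)
  ... | false = length-filterᵇ p xs

  ∑-++ : ∀ xs ys (f : A → ℕ) → ∑ (xs ++ ys) f ≡ ∑ xs f + ∑ ys f
  ∑-++ []       ys f = refl
  ∑-++ (x ∷ xs) ys f = trans (cong (f x +_) (∑-++ xs ys f)) (sym (+-assoc (f x) _ _))

  ∑-+ : ∀ xs (f g : A → ℕ) → ∑[ x ∈ xs ] (f x + g x) ≡ ∑ xs f + ∑ xs g
  ∑-+ []       f g = refl
  ∑-+ (x ∷ xs) f g = trans (cong (f x + g x +_) (∑-+ xs f g)) (interchange (f x) (g x) _ _)

  ∑-cong : ∀ xs {f g : A → ℕ} → (∀ {x} → x ∈ xs → f x ≡ g x) → ∑ xs f ≡ ∑ xs g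
  ∑-cong []       h = refl
  ∑-cong (x ∷ xs) h = cong₂ _+_ (h (here refl)) (∑-cong xs (λ m → h (there m)))

  ∑-mono-≤ : ∀ xs {f g : A → ℕ} → (∀ {x} → x ∈ xs → f x ≤ g x) → ∑ xs f ≤ ∑ xs g
  ∑-mono-≤ []       h = z≤n
  ∑-mono-≤ (x ∷ xs) h = +-mono-≤ (h (here refl)) (∑-mono-≤ xs (λ m → h (there m)))

  ∑-const-1 : ∀ (xs : List A) → ∑[ x ∈ xs ] 1 ≡ length xs
  ∑-const-1 []       = refl
  ∑-const-1 (x ∷ xs) = cong suc (∑-const-1 xs)

  ∑-zero : ∀ xs {f : A → ℕ} → (∀ {x} → x ∈ xs → f x ≡ 0) → ∑ xs f ≡ 0
  ∑-zero []       h = refl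
  ∑-zero (x ∷ xs) h = cong₂ _+_ (h (here refl)) (∑-zero xs (λ m → h (there m)))

  ∑≡0⇒zero : ∀ xs (f : A → ℕ) → ∑ xs f ≡ 0 → ∀ {x} → x ∈ xs → f x ≡ 0
  ∑≡0⇒zero (y ∷ xs) f e (here refl) = m+n≡0⇒m≡0 (f y) e
  ∑≡0⇒zero (y ∷ xs) f e (there m)   = ∑≡0⇒zero xs f (m+n≡0⇒n≡0 (f y) e) m

  ∑<length⇒zero : ∀ xs (f : A → ℕ) → ∑ xs f < length xs → Σ A λ x → x ∈ xs × f x ≡ 0
  ∑<length⇒zero (x ∷ xs) f lt with f x in fx
  ... | zero  = x , here refl , fx
  ... | suc k with y , m , fy ← ∑<length⇒zero xs f (≤-trans (s≤s (m≤n+m _ k)) (s≤s⁻¹ lt))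
    = y , there m , fy

  ∈⇒count-pos : ∀ (p : A → Bool) {xs x} → x ∈ xs → p x ≡ true → 1 ≤ ∑[ y ∈ xs ] 𝟙 (p y)
  ∈⇒count-pos p {y ∷ xs} (here refl) px rewrite px = s≤s z≤n
  ∈⇒count-pos p {y ∷ xs} (there m)   px = ≤-trans (∈⇒count-pos p m px) (m≤n+m _ (𝟙 (p y)))

  count-≤1 : ∀ (p : A → Bool) {xs} → Unique xs →
             (∀ {x y} → x ∈ xs → y ∈ xs → p x ≡ true → p y ≡ true → x ≡ y) →
             ∑[ x ∈ xs ] 𝟙 (p x) ≤ 1
  count-≤1 p {[]}     _          _   = z≤n
  count-≤1 p {x ∷ xs} (x∉ ∷ uxs) one with p x in px
  ... | false = count-≤1 p uxs (λ mx my → one (there mx) (there my))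
  ... | true  = s≤s (≤-reflexive (∑-zero xs (λ {y} m → others y m (All.lookup x∉ m))))
    where
      others : ∀ y → y ∈ xs → x ≢ y → 𝟙 (p y) ≡ 0
      others y m x≢y with p y in py
      ... | false = refl
      ... | true  = ⊥-elim (x≢y (one (here refl) (there m) px py))

module _ {A : Set} (_≟_ : (x y : A) → Dec (x ≡ y)) where

  position : List A → A → ℕ
  position []       a = 0
  position (x ∷ xs) a = if does (x ≟ a) then 0 else suc (position xs a)

  position-< : ∀ {xs a} → a ∈ xs → position xs a < length xs
  position-< {x ∷ xs} {a} a∈ with x ≟ a | a∈
  ... | yes _   | _           = s≤s z≤n
  ... | no x≢a  | here a≡x    = ⊥-elim (x≢a (sym a≡x))
  ... | no _    | there a∈xs  = s≤s (position-< a∈xs)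

  position-injective : ∀ {xs a b} → a ∈ xs → b ∈ xs → position xs a ≡ position xs b → a ≡ b
  position-injective {x ∷ xs} {a} {b} a∈ b∈ eq with x ≟ a | x ≟ b | a∈ | b∈
  ... | yes x≡a | yes x≡b | _          | _          = trans (sym x≡a) x≡b
  ... | no x≢a  | _       | here a≡x   | _          = ⊥-elim (x≢a (sym a≡x))
  ... | _       | no x≢b  | _          | here b≡x   = ⊥-elim (x≢b (sym b≡x))
  ... | no _    | no _    | there a∈xs | there b∈xs = position-injective a∈xs b∈xs (suc-injective eq)

  count-≟ : ∀ {xs a} → Unique xs → a ∈ xs → ∑[ x ∈ xs ] 𝟙 (does (x ≟ a)) ≡ 1
  count-≟ {xs} {a} uxs a∈ = ≤-antisym
    (count-≤1 (λ x → does (x ≟ a)) uxs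
      λ {x} {y} _ _ x≡a y≡a → trans (does⇒witness (x ≟ a) x≡a) (sym (does⇒witness (y ≟ a) y≡a)))
    (∈⇒count-pos (λ x → does (x ≟ a)) a∈ (dec-true (a ≟ a) refl))

∑-map : ∀ {A B : Set} (g : A → B) xs (f : B → ℕ) → ∑ (map g xs) f ≡ ∑[ x ∈ xs ] f (g x)
∑-map g []       f = refl
∑-map g (x ∷ xs) f = cong (f (g x) +_) (∑-map g xs f)

∑-concatMap : ∀ {A B : Set} (g : A → List B) xs (f : B → ℕ) →
              ∑ (concatMap g xs) f ≡ ∑[ x ∈ xs ] ∑ (g x) f
∑-concatMap g []       f = refl
∑-concatMap g (x ∷ xs) f =
  trans (∑-++ (g x) (concat (map g xs)) f) (cong (∑ (g x) f +_) (∑-concatMap g xs f))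

∑-comm : ∀ {A B : Set} xs ys (f : A → B → ℕ) →
         ∑[ x ∈ xs ] ∑[ y ∈ ys ] f x y ≡ ∑[ y ∈ ys ] ∑[ x ∈ xs ] f x y
∑-comm []       ys f = sym (∑-zero ys (λ _ → refl))
∑-comm (x ∷ xs) ys f =
  trans (cong (∑ ys (f x) +_) (∑-comm xs ys f)) (sym (∑-+ ys (f x) (λ y → ∑[ x ∈ xs ] f x y)))

-- The three cases at a vertex

data Shape (m k w : ℕ) (s : Bool) : Set where
  on-target      : (k ≤ 1 → 𝟙 s + w + k ≡ 1 + m) → (2 ≤ k → 𝟙 s + w + k ≡ 2 + m) → Shape m k w s
  needs-special  : k ≡ 0 → s ≡ false → w ≡ m → Shape m k w s
  special-blocks : 2 ≤ k → s ≡ true → w + k ≡ m → Shape m k w s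

shape-inners-full : ∀ k w s → k + w + (𝟙 s + 𝟙 s) ≤ 2 + w → Shape w k w s
shape-inners-full k w false h with +-cancelʳ-≤ w k 2 (subst (_≤ 2 + w) (+-identityʳ (k + w)) h)
... | z≤n           = needs-special refl refl refl
... | s≤s z≤n       = on-target (λ _ → +-comm w 1) (λ { (s≤s ()) })
... | s≤s (s≤s z≤n) = on-target (λ { (s≤s ()) }) (λ _ → +-comm w 2)
shape-inners-full k w true h
  with +-cancelʳ-≤ (2 + w) k 0 (subst (_≤ 2 + w) (trans (+-assoc k w 2) (cong (k +_) (+-comm w 2))) h)
... | z≤n = on-target (λ _ → +-identityʳ (1 + w)) (λ ())

shape-inner-free : ∀ m k w s → k + w + (𝟙 s + 𝟙 s) ≡ 2 + m → w < m → Shape m k w s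
shape-inner-free m k w false h w<m =
  on-target k≤1-impossible (λ _ → trans (+-comm w k) (trans (sym (+-identityʳ (k + w))) h))
  where
    k≤1-impossible : k ≤ 1 → 𝟙 false + w + k ≡ 1 + m
    k≤1-impossible k≤1 = ⊥-elim (<-irrefl h (begin-strict
      k + w + 0 ≡⟨ +-identityʳ (k + w) ⟩
      k + w     ≤⟨ +-monoˡ-≤ w k≤1 ⟩
      1 + w     ≤⟨ w<m ⟩
      m         <⟨ m<n+m m (s≤s z≤n) ⟩
      2 + m     ∎))
      where open ≤-Reasoning
shape-inner-free m k w true h w<m = by-k k (+-cancelʳ-≡ 2 (k + w) m (trans h (+-comm 2 m)))
  where
    by-k : ∀ k → k + w ≡ m → Shape m k w true
    by-k zero             h′ = ⊥-elim (<⇒≢ w<m h′)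
    by-k (suc zero)       h′ = on-target (λ _ → cong suc (trans (+-comm w 1) h′)) (λ { (s≤s ()) })
    by-k k@(suc (suc _))  h′ = special-blocks (s≤s (s≤s z≤n)) refl (trans (+-comm w k) h′)

shape : ∀ m k w s → k + w + (𝟙 s + 𝟙 s) ≤ 2 + m → w ≤ m →
        (w < m → 2 + m ≤ k + w + (𝟙 s + 𝟙 s)) → Shape m k w s
shape m k w s ports-once inners-once saturated with m≤n⇒m<n∨m≡n inners-once
... | inj₁ w<m  = shape-inner-free m k w s (≤-antisym ports-once (saturated w<m)) w<m
... | inj₂ refl = shape-inners-full k w s ports-once

-- Matchings of G′

module _ {n : ℕ} (G : SimpleGraph n) (S : SpecialChoice G) where

  xOf≢port : ∀ (w z v u : Fin n) → xOf w z ≢ port v u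
  xOf≢port w z v u with toℕ w ≤ᵇ toℕ z
  ... | true  = λ ()
  ... | false = λ ()

  xOf≢inner : ∀ (w z v : Fin n) i → xOf w z ≢ inner v i
  xOf≢inner w z v i with toℕ w ≤ᵇ toℕ z
  ... | true  = λ ()
  ... | false = λ ()

  data AtPort (v u : Fin n) : Edg n → Set where
    conn    : AtPort v u (conn v u)
    wedge   : ∀ j → AtPort v u (wedge v j u)
    special : u ≡ fst S v ⊎ u ≡ snd S v → AtPort v u (special v)

  atPort : ∀ {v u e} → IsEnd G S (port v u) e → AtPort v u e
  atPort {e = conn w z}    (inj₁ refl) = conn
  atPort {e = conn w z}    (inj₂ x≡)   = ⊥-elim (xOf≢port w z _ _ (sym x≡))
  atPort {e = wedge w j z} (inj₂ refl) = wedge j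
  atPort {e = special w}   (inj₁ refl) = special (inj₁ refl)
  atPort {e = special w}   (inj₂ refl) = special (inj₂ refl)

  atPort⇒isEnd : ∀ {v u e} → AtPort v u e → IsEnd G S (port v u) e
  atPort⇒isEnd conn                = inj₁ refl
  atPort⇒isEnd (wedge j)           = inj₂ refl
  atPort⇒isEnd (special (inj₁ refl)) = inj₁ refl
  atPort⇒isEnd (special (inj₂ refl)) = inj₂ refl

  atInner : ∀ {v i e} → IsEnd G S (inner v i) e → Σ (Fin n) λ z → e ≡ wedge v i z
  atInner {e = conn w z}    (inj₂ x≡)   = ⊥-elim (xOf≢inner w z _ _ (sym x≡))
  atInner {e = wedge w j z} (inj₁ refl) = z , refl

  Covered : EdgeSet G S → Vtx n → Set
  Covered M x = Σ (Edg n) λ e → M e ≡ true × IsEnd G S x e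

  Free : EdgeSet G S → Edg n → Set
  Free M e = ∀ {x} → IsEnd G S x e → ¬ Covered M x

  merge : (Edg n → Bool) → EdgeSet G S → EdgeSet G S → EdgeSet G S
  merge P A B e = if P e then B e else A e

  private
    merge-cases : ∀ P A B e → merge P A B e ≡ true →
                  (P e ≡ false × A e ≡ true) ⊎ (P e ≡ true × B e ≡ true)
    merge-cases P A B e h with P e
    ... | false = inj₁ (refl , h)
    ... | true  = inj₂ (refl , h)

  merge-isMatching : ∀ P {A B} → IsMatching G S A → IsMatching G S B →
    (∀ e f {x} → A e ≡ true → P e ≡ false → B f ≡ true → P f ≡ true →
                 IsEnd G S x e → IsEnd G S x f → ⊥) →
    IsMatching G S (merge P A B)
  merge-isMatching P {A} {B} (validA , uniqA) (validB , uniqB) disjoint = valid , uniq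
    where
      valid : ∀ e → merge P A B e ≡ true → Valid G S e
      valid e h with merge-cases P A B e h
      ... | inj₁ (_ , Ae) = validA e Ae
      ... | inj₂ (_ , Be) = validB e Be
      uniq : ∀ e f x → merge P A B e ≡ true → merge P A B f ≡ true →
             IsEnd G S x e → IsEnd G S x f → e ≡ f
      uniq e f x he hf xe xf with merge-cases P A B e he | merge-cases P A B f hf
      ... | inj₁ (_ , Ae)   | inj₁ (_ , Af)   = uniqA e f x Ae Af xe xf
      ... | inj₂ (_ , Be)   | inj₂ (_ , Bf)   = uniqB e f x Be Bf xe xf
      ... | inj₁ (Pe , Ae)  | inj₂ (Pf , Bf)  = ⊥-elim (disjoint e f Ae Pe Bf Pf xe xf)
      ... | inj₂ (Pe , Be)  | inj₁ (Pf , Af)  = ⊥-elim (disjoint f e Af Pf Be Pe xf xe)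

  _≟ᴱ_ : (e f : Edg n) → Dec (e ≡ f)
  conn w z ≟ᴱ conn w′ z′ with w ≟ᶠ w′ | z ≟ᶠ z′
  ... | yes refl | yes refl = yes refl
  ... | no w≢    | _        = no λ { refl → w≢ refl }
  ... | _        | no z≢    = no λ { refl → z≢ refl }
  wedge w i z ≟ᴱ wedge w′ i′ z′ with w ≟ᶠ w′ | i ≟ⁿ i′ | z ≟ᶠ z′
  ... | yes refl | yes refl | yes refl = yes refl
  ... | no w≢    | _        | _        = no λ { refl → w≢ refl }
  ... | _        | no i≢    | _        = no λ { refl → i≢ refl }
  ... | _        | _        | no z≢    = no λ { refl → z≢ refl }
  special w ≟ᴱ special w′ with w ≟ᶠ w′
  ... | yes refl = yes refl
  ... | no w≢    = no λ { refl → w≢ refl }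
  conn _ _    ≟ᴱ wedge _ _ _ = no λ ()
  conn _ _    ≟ᴱ special _   = no λ ()
  wedge _ _ _ ≟ᴱ conn _ _    = no λ ()
  wedge _ _ _ ≟ᴱ special _   = no λ ()
  special _   ≟ᴱ conn _ _    = no λ ()
  special _   ≟ᴱ wedge _ _ _ = no λ ()

  -- Adding a free edge is the merge with the one-edge matching {e}.
  maximal⇒¬free : ∀ {M} → IsMaximalMatching G S M → ∀ e → Valid G S e → ¬ Free M e
  maximal⇒¬free {M} (M-matching , M-maximal) e e-valid e-free =
    e-free (inj₁ refl) (e , M-maximal M+e M+e-matching M⊆M+e e e∈M+e , inj₁ refl)
    where
      is-e : EdgeSet G S
      is-e f = does (f ≟ᴱ e)
      is-e⇒≡ : ∀ {f} → is-e f ≡ true → f ≡ e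
      is-e⇒≡ {f} = does⇒witness (f ≟ᴱ e)
      M+e : EdgeSet G S
      M+e = merge is-e M is-e
      is-e-matching : IsMatching G S is-e
      is-e-matching = (λ f h → subst (Valid G S) (sym (is-e⇒≡ h)) e-valid)
                   , λ f g x hf hg _ _ → trans (is-e⇒≡ hf) (sym (is-e⇒≡ hg))
      M+e-matching : IsMatching G S M+e
      M+e-matching = merge-isMatching is-e M-matching is-e-matching
        λ f g Mf _ hg _ xf xg → e-free (subst (IsEnd G S _) (is-e⇒≡ {g} hg) xg) (f , Mf , xf)
      e∈M+e : M+e e ≡ true
      e∈M+e rewrite dec-true (e ≟ᴱ e) refl = refl
      M⊆M+e : _⊆_ G S M M+e
      M⊆M+e f Mf with is-e f
      ... | true  = refl
      ... | false = Mf

  card∩-++ : ∀ (H : EdgeSet G S) xs ys →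
             card∩ G S H (xs ++ ys) ≡ card∩ G S H xs + card∩ G S H ys
  card∩-++ H xs ys = begin
    length (filterᵇ H (xs ++ ys))         ≡⟨ length-filterᵇ H (xs ++ ys) ⟩
    ∑[ e ∈ xs ++ ys ] 𝟙 (H e)             ≡⟨ ∑-++ xs ys (λ e → 𝟙 (H e)) ⟩
    ∑[ e ∈ xs ] 𝟙 (H e) + ∑[ e ∈ ys ] 𝟙 (H e)
      ≡⟨ sym (cong₂ _+_ (length-filterᵇ H xs) (length-filterᵇ H ys)) ⟩
    length (filterᵇ H xs) + length (filterᵇ H ys) ∎
    where open ≡-Reasoning

  -- The gadget W_v

  module AtVertex (v : Fin n) where

    L : List (Fin n)
    L = nbrs G v

    m : ℕ
    m = deg G v ∸ 2

    a b : Fin n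
    a = fst S v
    b = snd S v

    nbrs-unique : Unique L
    nbrs-unique = filter⁺ (λ u → T? (adj G v u)) (allFin⁺ n)

    adj⇒∈nbrs : ∀ {u} → adj G v u ≡ true → u ∈ L
    adj⇒∈nbrs {u} h = ∈-filter⁺ (λ u → T? (adj G v u)) (∈-allFin u) (Equivalence.from T-≡ h)

    ∈nbrs⇒adj : ∀ {u} → u ∈ L → adj G v u ≡ true
    ∈nbrs⇒adj u∈ = Equivalence.to T-≡ (proj₂ (∈-filter⁻ (λ u → T? (adj G v u)) {xs = allFin n} u∈))

    wedgesAt : EdgeSet G S → Fin n → ℕ
    wedgesAt H u = ∑[ i ∈ upTo m ] 𝟙 (H (wedge v i u))

    card∩-W : ∀ H → card∩ G S H (edgesW G S v) ≡ 𝟙 (H (special v)) + ∑ L (wedgesAt H)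
    card∩-W H = begin
      length (filterᵇ H (edgesW G S v))
        ≡⟨ length-filterᵇ H (edgesW G S v) ⟩
      𝟙 (H (special v)) + ∑ (concatMap wedgesTo L) (λ e → 𝟙 (H e))
        ≡⟨ cong (𝟙 (H (special v)) +_) (∑-concatMap wedgesTo L (λ e → 𝟙 (H e))) ⟩
      𝟙 (H (special v)) + ∑[ u ∈ L ] ∑ (wedgesTo u) (λ e → 𝟙 (H e))
        ≡⟨ cong (𝟙 (H (special v)) +_) (∑-cong L (λ {u} _ → ∑-map (λ i → wedge v i u) (upTo m) _)) ⟩
      𝟙 (H (special v)) + ∑ L (wedgesAt H) ∎
      where
        open ≡-Reasoning
        wedgesTo : Fin n → List (Edg n)
        wedgesTo u = map (λ i → wedge v i u) (upTo m)

    card∩-F : ∀ H → card∩ G S H (edgesF G S v) ≡ ∑[ u ∈ L ] 𝟙 (H (conn v u))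
    card∩-F H = trans (length-filterᵇ H (edgesF G S v)) (∑-map (conn v) L (λ e → 𝟙 (H e)))

    ∑-complementary : ∀ (q r : Fin n → ℕ) → (∀ u → q u + r u ≡ 1) → ∑ L q + ∑ L r ≡ deg G v
    ∑-complementary q r q+r≡1 =
      trans (sym (∑-+ L q r)) (trans (∑-cong L (λ {u} _ → q+r≡1 u)) (∑-const-1 L))

    avoids-ends : Fin n → Bool
    avoids-ends u = not (does (u ≟ᶠ a)) ∧ not (does (u ≟ᶠ b))

    ends-avoided : avoids-ends a ≡ false × avoids-ends b ≡ false
    ends-avoided rewrite dec-true (a ≟ᶠ a) refl | dec-true (b ≟ᶠ b) refl = refl , ∧-zeroʳ _

    count-avoids-ends : length (filterᵇ avoids-ends L) + 2 ≡ deg G v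
    count-avoids-ends = begin
      length (filterᵇ avoids-ends L) + 2
        ≡⟨ cong₂ _+_ (length-filterᵇ avoids-ends L) (sym (trans (∑-+ L _ _) (cong₂ _+_
             (count-≟ _≟ᶠ_ nbrs-unique (adj⇒∈nbrs (fstAdj S v)))
             (count-≟ _≟ᶠ_ nbrs-unique (adj⇒∈nbrs (sndAdj S v)))))) ⟩
      ∑[ u ∈ L ] 𝟙 (avoids-ends u) + ∑[ u ∈ L ] (𝟙 (does (u ≟ᶠ a)) + 𝟙 (does (u ≟ᶠ b)))
        ≡⟨ ∑-complementary _ _ avoids-or-is-end ⟩
      deg G v ∎
      where
        open ≡-Reasoning
        avoids-or-is-end : ∀ u → 𝟙 (avoids-ends u) + (𝟙 (does (u ≟ᶠ a)) + 𝟙 (does (u ≟ᶠ b))) ≡ 1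
        avoids-or-is-end u with u ≟ᶠ a | u ≟ᶠ b
        ... | yes refl | yes a≡b = ⊥-elim (distinct S v a≡b)
        ... | yes _    | no _    = refl
        ... | no _     | yes _   = refl
        ... | no _     | no _    = refl

    module Loads (M : EdgeSet G S) (M-matching : IsMatching G S M) where

      k w s : ℕ
      k = ∑[ u ∈ L ] 𝟙 (M (conn v u))
      w = ∑ L (wedgesAt M)
      s = 𝟙 (M (special v))

      specialAt : Fin n → ℕ
      specialAt u = 𝟙 (M (special v) ∧ does (u ≟ᶠ a)) + 𝟙 (M (special v) ∧ does (u ≟ᶠ b))

      -- the number of M-edges at the port v'_{vu}; g_v is counted at both of its ports
      load : Fin n → ℕ
      load u = 𝟙 (M (conn v u)) + wedgesAt M u + specialAt u

      unique-at-port : ∀ {u e f} → M e ≡ true → M f ≡ true → AtPort v u e → AtPort v u f → e ≡ f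
      unique-at-port Me Mf pe pf = proj₂ M-matching _ _ _ Me Mf (atPort⇒isEnd pe) (atPort⇒isEnd pf)

      wedgesAt-≤1 : ∀ u → wedgesAt M u ≤ 1
      wedgesAt-≤1 u = count-≤1 (λ i → M (wedge v i u)) (upTo⁺ m)
        λ _ _ Mi Mj → same-index (unique-at-port Mi Mj (wedge _) (wedge _))
        where
          same-index : ∀ {i j} → wedge v i u ≡ wedge v j u → i ≡ j
          same-index refl = refl

      wedgesAt-≡0 : ∀ {u e} → M e ≡ true → AtPort v u e → (∀ {j} → e ≢ wedge v j u) →
                    wedgesAt M u ≡ 0
      wedgesAt-≡0 {u} Me pe not-wedge = ∑-zero (upTo m) no-wedge
        where
          no-wedge : ∀ {j} → j ∈ upTo m → 𝟙 (M (wedge v j u)) ≡ 0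
          no-wedge {j} _ with M (wedge v j u) in Mj
          ... | false = refl
          ... | true  = ⊥-elim (not-wedge (unique-at-port Me Mj pe (wedge j)))

      specialAt-≡0 : ∀ {u} → (M (special v) ≡ true → ¬ (u ≡ a ⊎ u ≡ b)) → specialAt u ≡ 0
      specialAt-≡0 {u} no-special with M (special v)
      ... | false = refl
      ... | true with u ≟ᶠ a | u ≟ᶠ b
      ...   | no _     | no _     = refl
      ...   | yes u≡a  | _        = ⊥-elim (no-special refl (inj₁ u≡a))
      ...   | no _     | yes u≡b  = ⊥-elim (no-special refl (inj₂ u≡b))

      conn-excludes-special : ∀ {u} → M (conn v u) ≡ true → M (special v) ≡ true → ¬ (u ≡ a ⊎ u ≡ b)
      conn-excludes-special Mc Ms end with () ← unique-at-port Mc Ms conn (special end)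

      load-≤1 : ∀ u → load u ≤ 1
      load-≤1 u with M (conn v u) in Mc
      ... | true = ≤-reflexive (cong suc (cong₂ _+_
            (wedgesAt-≡0 Mc conn λ ())
            (specialAt-≡0 (conn-excludes-special Mc))))
      ... | false with M (special v) in Ms
      ...   | false = ≤-trans (≤-reflexive (+-identityʳ (wedgesAt M u))) (wedgesAt-≤1 u)
      ...   | true with u ≟ᶠ a | u ≟ᶠ b
      ...     | yes refl | yes a≡b = ⊥-elim (distinct S v a≡b)
      ...     | yes refl | no _    = ≤-reflexive (cong (_+ 1) (wedgesAt-≡0 Ms (special (inj₁ refl)) λ ()))
      ...     | no _     | yes refl = ≤-reflexive (cong (_+ 1) (wedgesAt-≡0 Ms (special (inj₂ refl)) λ ()))
      ...     | no _     | no _    = ≤-trans (≤-reflexive (+-identityʳ (wedgesAt M u))) (wedgesAt-≤1 u)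

      k≡0⇒conn∉M : k ≡ 0 → ∀ u → M (conn v u) ≡ false
      k≡0⇒conn∉M k≡0 u with M (conn v u) in Mc
      ... | false = refl
      ... | true  = ⊥-elim (1+n≢0 (trans (cong 𝟙 (sym Mc))
                      (∑≡0⇒zero L (λ z → 𝟙 (M (conn v z))) k≡0 (adj⇒∈nbrs (proj₁ M-matching _ Mc)))))

      conn-free : Fin n → Bool
      conn-free u = not (M (conn v u))

      conn-free⇒conn∉M : ∀ {u} → conn-free u ≡ true → M (conn v u) ≡ false
      conn-free⇒conn∉M {u} h with M (conn v u)
      ... | false = refl

      count-conn-free : length (filterᵇ conn-free L) + k ≡ deg G v
      count-conn-free =
        trans (cong (_+ k) (length-filterᵇ conn-free L)) (∑-complementary _ _ free-or-matched)
        where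
          free-or-matched : ∀ u → 𝟙 (conn-free u) + 𝟙 (M (conn v u)) ≡ 1
          free-or-matched u with M (conn v u)
          ... | true  = refl
          ... | false = refl

      ∑-specialAt-end : ∀ {c} → c ∈ L → ∑[ u ∈ L ] 𝟙 (M (special v) ∧ does (u ≟ᶠ c)) ≡ s
      ∑-specialAt-end c∈L with M (special v)
      ... | true  = count-≟ _≟ᶠ_ nbrs-unique c∈L
      ... | false = ∑-zero L (λ _ → refl)

      ∑-load : ∑ L load ≡ k + w + (s + s)
      ∑-load = begin
        ∑ L load
          ≡⟨ ∑-+ L (λ u → 𝟙 (M (conn v u)) + wedgesAt M u) specialAt ⟩
        ∑[ u ∈ L ] (𝟙 (M (conn v u)) + wedgesAt M u) + ∑ L specialAt
          ≡⟨ cong₂ _+_ (∑-+ L (λ u → 𝟙 (M (conn v u))) (wedgesAt M)) (∑-+ L _ _) ⟩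
        k + w + (∑[ u ∈ L ] 𝟙 (M (special v) ∧ does (u ≟ᶠ a)) + ∑[ u ∈ L ] 𝟙 (M (special v) ∧ does (u ≟ᶠ b)))
          ≡⟨ cong (k + w +_) (cong₂ _+_ (∑-specialAt-end (adj⇒∈nbrs (fstAdj S v)))
                                        (∑-specialAt-end (adj⇒∈nbrs (sndAdj S v)))) ⟩
        k + w + (s + s) ∎
        where open ≡-Reasoning

      ports-matched-once : k + w + (s + s) ≤ deg G v
      ports-matched-once = begin
        k + w + (s + s)   ≡⟨ sym ∑-load ⟩
        ∑ L load          ≤⟨ ∑-mono-≤ L (λ {u} _ → load-≤1 u) ⟩
        ∑[ u ∈ L ] 1      ≡⟨ ∑-const-1 L ⟩
        deg G v           ∎
        where open ≤-Reasoning

      wedgesFrom : ℕ → ℕ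
      wedgesFrom i = ∑[ u ∈ L ] 𝟙 (M (wedge v i u))

      w≡∑wedgesFrom : w ≡ ∑ (upTo m) wedgesFrom
      w≡∑wedgesFrom = ∑-comm L (upTo m) (λ u i → 𝟙 (M (wedge v i u)))

      inners-matched-once : w ≤ m
      inners-matched-once = begin
        w                          ≡⟨ w≡∑wedgesFrom ⟩
        ∑ (upTo m) wedgesFrom      ≤⟨ ∑-mono-≤ (upTo m) (λ {i} _ → wedgesFrom-≤1 i) ⟩
        ∑[ i ∈ upTo m ] 1          ≡⟨ trans (∑-const-1 (upTo m)) (length-upTo m) ⟩
        m                          ∎
        where
          open ≤-Reasoning
          same-port : ∀ {i u z} → wedge v i u ≡ wedge v i z → u ≡ z
          same-port refl = refl
          wedgesFrom-≤1 : ∀ i → wedgesFrom i ≤ 1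
          wedgesFrom-≤1 i = count-≤1 (λ u → M (wedge v i u)) nbrs-unique
            λ _ _ Mu Mz → same-port (proj₂ M-matching _ _ (inner v i) Mu Mz (inj₁ refl) (inj₁ refl))

      covered⇒load-pos : ∀ {u} → Covered M (port v u) → 1 ≤ load u
      covered⇒load-pos {u} (e , Me , end) with atPort {e = e} end
      ... | conn rewrite Me = s≤s z≤n
      ... | wedge j = ≤-trans
            (∈⇒count-pos (λ i → M (wedge v i u)) (∈-upTo⁺ (proj₂ (proj₁ M-matching _ Me))) Me)
            (≤-trans (m≤n+m _ (𝟙 (M (conn v u)))) (m≤m+n _ (specialAt u)))
      ... | special (inj₁ refl) rewrite Me | dec-true (a ≟ᶠ a) refl =
            ≤-trans (m≤m+n 1 _) (m≤n+m _ (𝟙 (M (conn v u)) + wedgesAt M u))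
      ... | special (inj₂ refl) rewrite Me | dec-true (b ≟ᶠ b) refl =
            ≤-trans (m≤n+m 1 _) (m≤n+m _ (𝟙 (M (conn v u)) + wedgesAt M u))

      saturated : (∀ e → Valid G S e → ¬ Free M e) → w < m → deg G v ≤ k + w + (s + s)
      saturated no-free w<m = begin
        deg G v         ≡⟨ sym (∑-const-1 L) ⟩
        ∑[ u ∈ L ] 1    ≤⟨ ∑-mono-≤ L (λ u∈L → n≢0⇒n>0 (port-covered u∈L)) ⟩
        ∑ L load        ≡⟨ ∑-load ⟩
        k + w + (s + s) ∎
        where
          open ≤-Reasoning
          free-inner : Σ ℕ λ i → i ∈ upTo m × wedgesFrom i ≡ 0
          free-inner = ∑<length⇒zero (upTo m) wedgesFrom
            (subst₂ _<_ w≡∑wedgesFrom (sym (length-upTo m)) w<m)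
          i : ℕ
          i = proj₁ free-inner
          inner-uncovered : ¬ Covered M (inner v i)
          inner-uncovered (e , Me , end) with atInner {e = e} end
          ... | z , refl = 1+n≢0 (trans (cong 𝟙 (sym Me))
                     (∑≡0⇒zero L _ (proj₂ (proj₂ free-inner)) (adj⇒∈nbrs (proj₁ (proj₁ M-matching _ Me)))))
          port-covered : ∀ {u} → u ∈ L → load u ≢ 0
          port-covered {u} u∈L load≡0 = no-free (wedge v i u) (∈nbrs⇒adj u∈L , ∈-upTo⁻ (proj₁ (proj₂ free-inner))) λ
            { (inj₁ refl) → inner-uncovered
            ; (inj₂ refl) c → n≮0 (subst (1 ≤_) load≡0 (covered⇒load-pos c)) }

    inWᵇ : Edg n → Bool
    inWᵇ (conn _ _)    = false
    inWᵇ (wedge w _ _) = does (w ≟ᶠ v)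
    inWᵇ (special w)   = does (w ≟ᶠ v)

    v≟v : does (v ≟ᶠ v) ≡ true
    v≟v = dec-true (v ≟ᶠ v) refl

    valid-inWᵇ⇒InW : ∀ {e} → inWᵇ e ≡ true → Valid G S e → InW G S v e
    valid-inWᵇ⇒InW {wedge w i u} h e-valid = does⇒witness (w ≟ᶠ v) h , e-valid
    valid-inWᵇ⇒InW {special w}   h _       = does⇒witness (w ≟ᶠ v) h

    outside-at-port : ∀ {u e} → IsEnd G S (port v u) e → inWᵇ e ≡ false → e ≡ conn v u
    outside-at-port {e = e} end out with atPort {e = e} end
    ... | conn      = refl
    ... | wedge _   with () ← trans (sym v≟v) out
    ... | special _ with () ← trans (sym v≟v) out

    outside-not-at-inner : ∀ {i e} → IsEnd G S (inner v i) e → inWᵇ e ≡ false → ⊥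
    outside-not-at-inner {e = e} end out with atInner {e = e} end
    ... | _ , refl with () ← trans (sym v≟v) out

    -- N replaces M ∩ E(W_v) by X: g_v if use-special, and an edge from each chosen port v'_{vu}
    -- to the inner vertex v''_{slot u}, where slot u is the position of u among the chosen ports.
    module Rematch (M : EdgeSet G S) (M-matching : IsMatching G S M)
                   (chosen : Fin n → Bool) (use-special : Bool)
                   (chosen-conn-free : ∀ {u} → chosen u ≡ true → M (conn v u) ≡ false)
                   (special-ends-ok : use-special ≡ true →
                                      (M (conn v a) ≡ false × M (conn v b) ≡ false) ×
                                      (chosen a ≡ false × chosen b ≡ false))
                   (chosen-fit : length (filterᵇ chosen L) ≤ m) where

      R : List (Fin n)
      R = filterᵇ chosen L

      slot : Fin n → ℕ
      slot = position _≟ᶠ_ R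

      adj⇒∈R : ∀ {u} → adj G v u ≡ true → chosen u ≡ true → u ∈ R
      adj⇒∈R {u} vu cu = ∈-filter⁺ (λ u → T? (chosen u)) (adj⇒∈nbrs vu) (Equivalence.from T-≡ cu)

      slot-< : ∀ {u} → adj G v u ≡ true → chosen u ≡ true → slot u < m
      slot-< vu cu = ≤-trans (position-< _≟ᶠ_ (adj⇒∈R vu cu)) chosen-fit

      X : EdgeSet G S
      X (conn _ _)    = false
      X (wedge w i u) = does (w ≟ᶠ v) ∧ (adj G v u ∧ (chosen u ∧ does (i ≟ⁿ slot u)))
      X (special w)   = does (w ≟ᶠ v) ∧ use-special

      data XEdge : Edg n → Set where
        wedge   : ∀ {u} → adj G v u ≡ true → chosen u ≡ true → XEdge (wedge v (slot u) u)
        special : use-special ≡ true → XEdge (special v)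

      X-cases : ∀ {e} → X e ≡ true → XEdge e
      X-cases {wedge w i u} h with w ≟ᶠ v | adj G v u in vu | chosen u in cu
      ... | yes refl | true | true with refl ← does⇒witness (i ≟ⁿ slot u) h = wedge vu cu
      X-cases {special w} h with w ≟ᶠ v | h
      ... | yes refl | s = special s

      X-matching : IsMatching G S X
      X-matching = valid , unique
        where
          valid : ∀ e → X e ≡ true → Valid G S e
          valid e h with X-cases {e} h
          ... | wedge vu cu = vu , slot-< vu cu
          ... | special _   = _
          inner-index : ∀ {i j} → inner v i ≡ inner v j → i ≡ j
          inner-index refl = refl
          same-inner : ∀ {u z} → adj G v u ≡ true → chosen u ≡ true → adj G v z ≡ true → chosen z ≡ true →
                       inner v (slot u) ≡ inner v (slot z) → wedge v (slot u) u ≡ wedge v (slot z) z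
          same-inner vu cu vz cz eq
            with refl ← position-injective _≟ᶠ_ (adj⇒∈R vu cu) (adj⇒∈R vz cz) (inner-index eq) = refl
          wedge∦special : ∀ {u x} → adj G v u ≡ true → chosen u ≡ true → use-special ≡ true →
                          IsEnd G S x (wedge v (slot u) u) → IsEnd G S x (special v) → ⊥
          wedge∦special _ cu s (inj₂ refl) (inj₁ refl) with () ← trans (sym cu) (proj₁ (proj₂ (special-ends-ok s)))
          wedge∦special _ cu s (inj₂ refl) (inj₂ refl) with () ← trans (sym cu) (proj₂ (proj₂ (special-ends-ok s)))
          unique : ∀ e f x → X e ≡ true → X f ≡ true → IsEnd G S x e → IsEnd G S x f → e ≡ f
          unique e f x he hf xe xf with X-cases {e} he | X-cases {f} hf | xe | xf
          ... | special _   | special _   | _         | _         = refl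
          ... | wedge vu cu | wedge vz cz | inj₁ refl | inj₁ eq   = same-inner vu cu vz cz eq
          ... | wedge _ _   | wedge _ _   | inj₂ refl | inj₂ refl = refl
          ... | wedge vu cu | special s   | _         | _         = ⊥-elim (wedge∦special vu cu s xe xf)
          ... | special s   | wedge vu cu | _         | _         = ⊥-elim (wedge∦special vu cu s xf xe)

      N : EdgeSet G S
      N = merge inWᵇ M X

      N-matching : IsMatching G S N
      N-matching = merge-isMatching inWᵇ M-matching X-matching disjoint
        where
          port-blocked : ∀ {e u} → M e ≡ true → inWᵇ e ≡ false → M (conn v u) ≡ false →
                         IsEnd G S (port v u) e → ⊥
          port-blocked {e} Me out conn∉M xe with () ←
            trans (sym Me) (trans (cong M (outside-at-port {e = e} xe out)) conn∉M)
          disjoint : ∀ e f {x} → M e ≡ true → inWᵇ e ≡ false → X f ≡ true → inWᵇ f ≡ true →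
                     IsEnd G S x e → IsEnd G S x f → ⊥
          disjoint e f Me out hf _ xe xf with X-cases {f} hf | xf
          ... | wedge _ _  | inj₁ refl = outside-not-at-inner {e = e} xe out
          ... | wedge _ cu | inj₂ refl = port-blocked Me out (chosen-conn-free cu) xe
          ... | special s  | inj₁ refl = port-blocked Me out (proj₁ (proj₁ (special-ends-ok s))) xe
          ... | special s  | inj₂ refl = port-blocked Me out (proj₂ (proj₁ (special-ends-ok s))) xe

      N-agrees : ∀ e → ¬ InW G S v e → N e ≡ M e
      N-agrees e e∉W with inWᵇ e in e-in
      ... | false = refl
      ... | true  = trans (absent X (proj₁ X-matching e)) (sym (absent M (proj₁ M-matching e)))
        where
          absent : ∀ (H : EdgeSet G S) → (H e ≡ true → Valid G S e) → H e ≡ false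
          absent H valid with H e in He
          ... | false = refl
          ... | true  = ⊥-elim (e∉W (valid-inWᵇ⇒InW e-in (valid refl)))

      N-card-W : card∩ G S N (edgesW G S v) ≡ 𝟙 use-special + length R
      N-card-W = begin
        card∩ G S N (edgesW G S v)               ≡⟨ card∩-W N ⟩
        𝟙 (N (special v)) + ∑ L (wedgesAt N)     ≡⟨ cong₂ _+_ N-special (∑-cong L N-wedgesAt) ⟩
        𝟙 use-special + ∑[ u ∈ L ] 𝟙 (chosen u)  ≡⟨ cong (𝟙 use-special +_) (sym (length-filterᵇ chosen L)) ⟩
        𝟙 use-special + length R                 ∎
        where
          open ≡-Reasoning
          N-special : 𝟙 (N (special v)) ≡ 𝟙 use-special
          N-special rewrite v≟v = refl
          N-wedgesAt : ∀ {u} → u ∈ L → wedgesAt N u ≡ 𝟙 (chosen u)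
          N-wedgesAt {u} u∈L rewrite v≟v | ∈nbrs⇒adj u∈L with chosen u in cu
          ... | true  = count-≟ _≟ⁿ_ (upTo⁺ m) (∈-upTo⁺ (slot-< (∈nbrs⇒adj u∈L) cu))
          ... | false = ∑-zero (upTo m) (λ _ → refl)

      N-card : card∩ G S N (edgesW G S v ++ edgesF G S v) ≡ 𝟙 use-special + length R + card∩ G S M (edgesF G S v)
      N-card = begin
        card∩ G S N (edgesW G S v ++ edgesF G S v)             ≡⟨ card∩-++ N (edgesW G S v) (edgesF G S v) ⟩
        card∩ G S N (edgesW G S v) + card∩ G S N (edgesF G S v) ≡⟨ cong₂ _+_ N-card-W (card∩-F N) ⟩
        𝟙 use-special + length R + ∑[ u ∈ L ] 𝟙 (M (conn v u)) ≡⟨ cong (𝟙 use-special + length R +_) (sym (card∩-F M)) ⟩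
        𝟙 use-special + length R + card∩ G S M (edgesF G S v)  ∎
        where open ≡-Reasoning

    module Outcomes (2≤deg : 2 ≤ deg G v) (M : EdgeSet G S) (M-maximal : IsMaximalMatching G S M) where

      M-matching : IsMatching G S M
      M-matching = proj₁ M-maximal

      open Loads M M-matching public

      W F : List (Edg n)
      W = edgesW G S v
      F = edgesF G S v

      Claim : EdgeSet G S → Set
      Claim N =
        IsMatching G S N ×
        (∀ e → ¬ InW G S v e → N e ≡ M e) ×
        ((∀ e → N e ≡ M e) ⊎ card∩ G S N W ≡ suc (card∩ G S M W)) ×
        (card∩ G S M F ≤ 1 → card∩ G S N (W ++ F) ≡ deg G v ∸ 1) ×
        (2 ≤ card∩ G S M F → card∩ G S N (W ++ F) ≡ deg G v)

      deg≡2+m : deg G v ≡ 2 + m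
      deg≡2+m = sym (m+[n∸m]≡n 2≤deg)

      deg∸1≡1+m : deg G v ∸ 1 ≡ 1 + m
      deg∸1≡1+m = cong (_∸ 1) deg≡2+m

      card-M-W : card∩ G S M W ≡ s + w
      card-M-W = card∩-W M

      card-M-F : card∩ G S M F ≡ k
      card-M-F = card∩-F M

      shape-at-v : Shape m k w (M (special v))
      shape-at-v = shape m k w (M (special v))
        (subst (k + w + (s + s) ≤_) deg≡2+m ports-matched-once)
        inners-matched-once
        (λ w<m → subst (_≤ k + w + (s + s)) deg≡2+m (saturated (maximal⇒¬free M-maximal) w<m))

      keep : (k ≤ 1 → s + w + k ≡ 1 + m) → (2 ≤ k → s + w + k ≡ 2 + m) → Claim M
      keep on-1 on-2 = M-matching , (λ _ _ → refl) , inj₁ (λ _ → refl)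
        , (λ k≤1 → trans card-M (trans (on-1 (subst (_≤ 1) card-M-F k≤1)) (sym deg∸1≡1+m)))
        , (λ 2≤k → trans card-M (trans (on-2 (subst (2 ≤_) card-M-F 2≤k)) (sym deg≡2+m)))
        where
          card-M : card∩ G S M (W ++ F) ≡ s + w + k
          card-M = trans (card∩-++ M W F) (cong₂ _+_ card-M-W card-M-F)

      add-special : k ≡ 0 → M (special v) ≡ false → w ≡ m → Σ (EdgeSet G S) Claim
      add-special k≡0 Ms≡false w≡m = N , N-matching , N-agrees , inj₂ gain , (λ _ → total) , k≥2-impossible
        where
          conn∉M : ∀ u → M (conn v u) ≡ false
          conn∉M = k≡0⇒conn∉M k≡0
          |R|≡m : length (filterᵇ avoids-ends L) ≡ m
          |R|≡m = +-cancelʳ-≡ 2 _ _ (trans count-avoids-ends (trans deg≡2+m (+-comm 2 m)))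
          open Rematch M M-matching avoids-ends true (λ {u} _ → conn∉M u)
            (λ _ → (conn∉M a , conn∉M b) , ends-avoided) (≤-reflexive |R|≡m)
          gain : card∩ G S N W ≡ suc (card∩ G S M W)
          gain = begin
            card∩ G S N W       ≡⟨ N-card-W ⟩
            suc (length R)      ≡⟨ cong suc (trans |R|≡m (sym w≡m)) ⟩
            suc w               ≡⟨ cong (λ t → suc (𝟙 t + w)) (sym Ms≡false) ⟩
            suc (s + w)         ≡⟨ cong suc (sym card-M-W) ⟩
            suc (card∩ G S M W) ∎
            where open ≡-Reasoning
          total : card∩ G S N (W ++ F) ≡ deg G v ∸ 1
          total = begin
            card∩ G S N (W ++ F)                ≡⟨ N-card ⟩
            suc (length R) + card∩ G S M F      ≡⟨ cong₂ (λ r t → suc r + t) |R|≡m (trans card-M-F k≡0) ⟩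
            suc m + 0                           ≡⟨ +-identityʳ (suc m) ⟩
            suc m                               ≡⟨ sym deg∸1≡1+m ⟩
            deg G v ∸ 1                         ∎
            where open ≡-Reasoning
          k≥2-impossible : 2 ≤ card∩ G S M F → card∩ G S N (W ++ F) ≡ deg G v
          k≥2-impossible 2≤k = ⊥-elim (n≮0 (subst (2 ≤_) (trans card-M-F k≡0) 2≤k))

      drop-special : 2 ≤ k → M (special v) ≡ true → w + k ≡ m → Σ (EdgeSet G S) Claim
      drop-special 2≤k Ms≡true w+k≡m = N , N-matching , N-agrees , inj₂ gain , k≤1-impossible , (λ _ → total)
        where
          |R|≡2+w : length (filterᵇ conn-free L) ≡ 2 + w
          |R|≡2+w = +-cancelʳ-≡ k _ _ (trans count-conn-free (trans deg≡2+m (cong (2 +_) (sym w+k≡m))))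
          |R|≤m : length (filterᵇ conn-free L) ≤ m
          |R|≤m = +-cancelˡ-≤ 2 _ _ (begin
            2 + length (filterᵇ conn-free L)   ≡⟨ +-comm 2 _ ⟩
            length (filterᵇ conn-free L) + 2   ≤⟨ +-monoʳ-≤ _ 2≤k ⟩
            length (filterᵇ conn-free L) + k   ≡⟨ trans count-conn-free deg≡2+m ⟩
            2 + m                              ∎)
            where open ≤-Reasoning
          open Rematch M M-matching conn-free false conn-free⇒conn∉M (λ ()) |R|≤m
          gain : card∩ G S N W ≡ suc (card∩ G S M W)
          gain = begin
            card∩ G S N W       ≡⟨ N-card-W ⟩
            length R            ≡⟨ |R|≡2+w ⟩
            suc (1 + w)         ≡⟨ cong (λ t → suc (𝟙 t + w)) (sym Ms≡true) ⟩
            suc (s + w)         ≡⟨ cong suc (sym card-M-W) ⟩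
            suc (card∩ G S M W) ∎
            where open ≡-Reasoning
          total : card∩ G S N (W ++ F) ≡ deg G v
          total = begin
            card∩ G S N (W ++ F)       ≡⟨ N-card ⟩
            length R + card∩ G S M F   ≡⟨ cong (length R +_) card-M-F ⟩
            length R + k               ≡⟨ count-conn-free ⟩
            deg G v                    ∎
            where open ≡-Reasoning
          k≤1-impossible : card∩ G S M F ≤ 1 → card∩ G S N (W ++ F) ≡ deg G v ∸ 1
          k≤1-impossible k≤1 = ⊥-elim (1+n≰n (≤-trans 2≤k (subst (_≤ 1) card-M-F k≤1)))

lemma1 : (n : ℕ) (G : SimpleGraph n) → (∀ v → 2 ≤ deg G v) →
         (S : SpecialChoice G) (M : EdgeSet G S) → IsMaximalMatching G S M →
         (v : Fin n) →
         Σ (EdgeSet G S) (λ N →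
           IsMatching G S N ×
           (∀ e → ¬ InW G S v e → N e ≡ M e) ×
           ((∀ e → N e ≡ M e) ⊎ card∩ G S N (edgesW G S v) ≡ suc (card∩ G S M (edgesW G S v))) ×
           (card∩ G S M (edgesF G S v) ≤ 1 → card∩ G S N (edgesW G S v ++ edgesF G S v) ≡ deg G v ∸ 1) ×
           (2 ≤ card∩ G S M (edgesF G S v) → card∩ G S N (edgesW G S v ++ edgesF G S v) ≡ deg G v))
lemma1 n G 2≤deg S M M-maximal v = by-shape shape-at-v
  where
    open AtVertex G S v
    open Outcomes (2≤deg v) M M-maximal
    by-shape : Shape m k w (M (special v)) → Σ (EdgeSet G S) Claim
    by-shape (on-target on-1 on-2)                   = M , keep on-1 on-2
    by-shape (needs-special k≡0 Ms≡false w≡m)        = add-special k≡0 Ms≡false w≡m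
    by-shape (special-blocks 2≤k Ms≡true w+k≡m)      = drop-special 2≤k Ms≡true w+k≡m
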